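{- Let $W(n)$ denote the set of vectors $v\in\mathbb{F}_2^n$ that work. For $n$ odd, $W(n)=\{v\in\mathbb{F}_2^n: |v|=0\}$. For $a$ odd and $b\in\mathbb{N}$, $$W(a2^b)=\left\{\left(v_0^{(1)},\dots,v_0^{(2^b)},v_1^{(1)},\dots,v_1^{(2^b)},\dots,v_{a-1}^{(1)},\dots,v_{a-1}^{(2^b)}\right): v^{(1)},\dots,v^{(2^b)}\in W(a)\right\}.$$
   Context: Vectors in $\mathbb{F}_2^n$ are indexed $x=(x_0,\dots,x_{n-1})$ with indices mod $n$; $\sigma$ is the cyclic shift $(\sigma x)_{i+1}=x_i$. For $x\in\mathbb{F}_2^n$, $|x|=\sum_i x_i\in\mathbb{F}_2$. A vector $v\in\mathbb{F}_2^n$ works if for every $x\in\mathbb{F}_2^n$ there is $k\in\{0,\dots,n-1\}$ with $v\cdot\sigma^kx=0$. -}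

module Defs where

open import Data.Nat using (ℕ; zero; suc)
open import Data.Bool using (Bool; true; false; _xor_; _∧_)
open import Data.Fin using (Fin; zero; suc; fromℕ; inject₁; toℕ)
open import Data.Product using (∃)
open import Relation.Binary.PropositionalEquality using (_≡_)

-- Vectors in 𝔽₂ⁿ: functions Fin n → Bool (true = 1, false = 0, xor = +, ∧ = ·).
F2^ : ℕ → Set
F2^ n = Fin n → Bool

cpred : {n : ℕ} → Fin n → Fin n
cpred {suc m} zero    = fromℕ m
cpred {suc m} (suc i) = inject₁ i

σ : {n : ℕ} → F2^ n → F2^ n
σ x j = x (cpred j)

σ^ : {n : ℕ} → ℕ → F2^ n → F2^ n
σ^ zero    x = x
σ^ (suc k) x = σ (σ^ k x)

Σ₂ : {n : ℕ} → (Fin n → Bool) → Bool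
Σ₂ {zero}  f = false
Σ₂ {suc n} f = f zero xor Σ₂ (λ i → f (suc i))

_·_ : {n : ℕ} → F2^ n → F2^ n → Bool
v · x = Σ₂ (λ i → v i ∧ x i)

∣_∣₂ : {n : ℕ} → F2^ n → Bool
∣ x ∣₂ = Σ₂ x

Works : {n : ℕ} → F2^ n → Set
Works {n} v = (x : F2^ n) → ∃ λ (k : Fin n) → v · σ^ (toℕ k) x ≡ false

open import Data.Nat using (_+_; _*_)
Odd : ℕ → Set
Odd n = ∃ λ m → n ≡ suc (2 * m)

module Submission where

-- Write n = a·m with a odd and m = 2^b, and extend vectors of 𝔽₂ⁿ
-- n-periodically to sequences on ℕ.  Then v·σᵏx is the cyclic correlation
-- Σᵢ v_{k+i} x_i, and v works iff for every x some correlation vanishes.  The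
-- residues R_j = Σ_p v_{pm+j} (j mod m) of v decide the question:
--  * if all R_j vanish, the correlations at the a shifts 0, m, …, (a-1)m add
--    up to a pairing against the residues of v, which is 0; as a is odd they
--    cannot all be 1, so v works;
--  * if some R_j = 1, the m-periodic sequence R has a "dual" g: an m-periodic
--    sequence whose correlation with R is 1 at every shift (dual-exists, by
--    induction on b; this is where m = 2^b is used).  Taking x = g, every
--    correlation of v with x equals the correlation of R with g, i.e. 1.
-- The file develops 𝔽₂-sums of sequences, periodicity and residues, the dual
-- lemma, the translation from vectors and cyclic shifts to sequences and
-- correlations, the residue criterion, and finally the two statements: for n
-- odd (b = 0) the only residue is the weight |v|; for n = a·2^b the residues
-- are the weights of the 2^b interleaved columns of v.

open import Defs
open import Algebra.Bundles using (CommutativeRing)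
open import Data.Bool using (Bool; true; false; not; _xor_; _∧_)
open import Data.Bool.Properties
  using ( xor-assoc; xor-comm; xor-identityʳ; xor-inverseʳ; ∧-comm; ∧-identityʳ; ∧-zeroʳ
        ; ∧-distribˡ-xor; ∧-distribʳ-xor; not-involutive; xor-∧-commutativeRing)
open import Data.Fin using (Fin; combine; zero; suc; toℕ; fromℕ<; inject₁)
open import Data.Fin.Properties
  using (toℕ-injective; toℕ-fromℕ; toℕ-fromℕ<; toℕ-inject₁; toℕ<n; toℕ-combine)
open import Data.Nat using (ℕ; zero; suc; _+_; _*_; _^_; _<_; z≤n; s≤s; NonZero)
open import Data.Nat.Properties
  using ( +-identityʳ; +-assoc; +-comm; +-suc; *-comm; *-identityʳ; n<1+n; m<n⇒m<1+n
        ; m*n≢0; m^n≢0; +-commutativeSemigroup)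
open import Data.Nat.DivMod
  using ( _%_; _/_; _mod_; m≡m%n+[m/n]*n; m%n<n; [m+n]%n≡m%n; m<n⇒m%n≡m; %-distribˡ-+
        ; +-distrib-/-∣ˡ; n/n≡1)
open import Data.Nat.Divisibility using (∣-refl)
open import Data.Nat.Tactic.RingSolver using (solve-∀)
open import Data.Product using (_×_; ∃; _,_)
open import Data.Sum using (_⊎_; inj₁; inj₂; [_,_]′)
open import Function.Bundles using (_⇔_; mk⇔; Equivalence)
open import Relation.Nullary using (¬_; contradiction)
open import Relation.Binary.PropositionalEquality
  using (_≡_; refl; sym; trans; cong; cong₂; subst; module ≡-Reasoning)

open import Algebra.Properties.CommutativeSemigroup
  (CommutativeRing.+-commutativeSemigroup xor-∧-commutativeRing)
  using () renaming (interchange to xor-interchange)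
open import Algebra.Properties.CommutativeSemigroup +-commutativeSemigroup
  using ()
  renaming ( x∙yz≈xz∙y to m+[n+o]≡m+o+n; x∙yz≈y∙xz to m+[n+o]≡n+[m+o]
           ; xy∙z≈xz∙y to m+n+o≡m+o+n)

sum₂ : ℕ → (ℕ → Bool) → Bool
sum₂ zero    f = false
sum₂ (suc n) f = f 0 xor sum₂ n (λ i → f (suc i))

sum₂-cong< : ∀ n {f g : ℕ → Bool} → (∀ i → i < n → f i ≡ g i) → sum₂ n f ≡ sum₂ n g
sum₂-cong< zero    eq = refl
sum₂-cong< (suc n) eq =
  cong₂ _xor_ (eq 0 (s≤s z≤n)) (sum₂-cong< n (λ i i<n → eq (suc i) (s≤s i<n)))

sum₂-cong : ∀ n {f g : ℕ → Bool} → (∀ i → f i ≡ g i) → sum₂ n f ≡ sum₂ n g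
sum₂-cong n eq = sum₂-cong< n (λ i _ → eq i)

sum₂-zero : ∀ n → sum₂ n (λ _ → false) ≡ false
sum₂-zero zero    = refl
sum₂-zero (suc n) = sum₂-zero n

sum₂-+ : ∀ m k f → sum₂ (m + k) f ≡ sum₂ m f xor sum₂ k (λ i → f (m + i))
sum₂-+ zero    k f = refl
sum₂-+ (suc m) k f =
  trans (cong (f 0 xor_) (sum₂-+ m k (λ i → f (suc i)))) (sym (xor-assoc (f 0) _ _))

sum₂-xor : ∀ n f g → sum₂ n (λ i → f i xor g i) ≡ sum₂ n f xor sum₂ n g
sum₂-xor zero    f g = refl
sum₂-xor (suc n) f g =
  trans (cong ((f 0 xor g 0) xor_) (sum₂-xor n _ _)) (xor-interchange (f 0) (g 0) _ _)

sum₂-∧ˡ : ∀ n b f → sum₂ n (λ i → b ∧ f i) ≡ b ∧ sum₂ n f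
sum₂-∧ˡ n true  f = refl
sum₂-∧ˡ n false f = sum₂-zero n

sum₂-∧ʳ : ∀ n b f → sum₂ n (λ i → f i ∧ b) ≡ sum₂ n f ∧ b
sum₂-∧ʳ n b f = begin
  sum₂ n (λ i → f i ∧ b)  ≡⟨ sum₂-cong n (λ i → ∧-comm (f i) b) ⟩
  sum₂ n (λ i → b ∧ f i)  ≡⟨ sum₂-∧ˡ n b f ⟩
  b ∧ sum₂ n f            ≡⟨ ∧-comm b _ ⟩
  sum₂ n f ∧ b            ∎
  where open ≡-Reasoning

sum₂-swap : ∀ m k (f : ℕ → ℕ → Bool) →
  sum₂ m (λ i → sum₂ k (λ j → f i j)) ≡ sum₂ k (λ j → sum₂ m (λ i → f i j))
sum₂-swap zero    k f = sym (sum₂-zero k)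
sum₂-swap (suc m) k f =
  trans (cong (sum₂ k (f 0) xor_) (sum₂-swap m k (λ i → f (suc i))))
        (sym (sum₂-xor k (f 0) (λ j → sum₂ m (λ i → f (suc i) j))))

sum₂-blocks : ∀ p q f → sum₂ (p * q) f ≡ sum₂ p (λ i → sum₂ q (λ j → f (i * q + j)))
sum₂-blocks zero    q f = refl
sum₂-blocks (suc p) q f =
  trans (sum₂-+ q (p * q) f)
        (cong (sum₂ q f xor_)
              (trans (sum₂-blocks p q (λ i → f (q + i)))
                     (sum₂-cong p (λ i → sum₂-cong q (λ j → cong f (sym (+-assoc q (i * q) j)))))))

sum₂-halves : ∀ m f → sum₂ (m + m) f ≡ sum₂ m (λ j → f j xor f (m + j))
sum₂-halves m f = trans (sum₂-+ m m f) (sym (sum₂-xor m f (λ j → f (m + j))))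

sum₂-snoc : ∀ n f → sum₂ (suc n) f ≡ sum₂ n f xor f n
sum₂-snoc zero    f = xor-identityʳ (f 0)
sum₂-snoc (suc n) f =
  trans (cong (f 0 xor_) (sum₂-snoc n (λ i → f (suc i)))) (sym (xor-assoc (f 0) _ _))

isOdd : ℕ → Bool
isOdd zero    = false
isOdd (suc n) = not (isOdd n)

isOdd-odd : ∀ k → isOdd (suc (2 * k)) ≡ true
isOdd-odd k = cong not (trans (cong isOdd (cong (k +_) (+-identityʳ k))) (isOdd-double k))
  where
  isOdd-double : ∀ k → isOdd (k + k) ≡ false
  isOdd-double zero    = refl
  isOdd-double (suc k) = trans (cong (λ t → not (isOdd t)) (+-suc k k))
                               (trans (not-involutive _) (isOdd-double k))

sum₂-false-or-parity : ∀ a (f : ℕ → Bool) → (∃ λ l → f l ≡ false) ⊎ (sum₂ a f ≡ isOdd a)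
sum₂-false-or-parity zero    f = inj₂ refl
sum₂-false-or-parity (suc a) f with f 0 in f0
... | false = inj₁ (0 , f0)
... | true with sum₂-false-or-parity a (λ i → f (suc i))
...   | inj₁ (l , fl) = inj₁ (suc l , fl)
...   | inj₂ parity   = inj₂ (cong not parity)

true-or-false-below : ∀ k (f : ℕ → Bool) → (∃ λ j → f j ≡ true) ⊎ (∀ j → j < k → f j ≡ false)
true-or-false-below zero    f = inj₂ (λ j ())
true-or-false-below (suc k) f with f 0 in f0
... | true  = inj₁ (0 , f0)
... | false with true-or-false-below k (λ i → f (suc i))
...   | inj₁ (j , fj) = inj₁ (suc j , fj)
...   | inj₂ below    = inj₂ λ { zero _ → f0 ; (suc j) (s≤s j<k) → below j j<k }

xor≡false⇒≡ : ∀ x y → x xor y ≡ false → x ≡ y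
xor≡false⇒≡ false false _ = refl
xor≡false⇒≡ true  true  _ = refl

∧-split : ∀ x y → (x ∧ y) xor (x ∧ not y) ≡ x
∧-split x y = begin
  (x ∧ y) xor (x ∧ not y)  ≡⟨ sym (∧-distribˡ-xor x y (not y)) ⟩
  x ∧ (y xor not y)        ≡⟨ cong (x ∧_) (xor-inverseʳ y) ⟩
  x ∧ true                 ≡⟨ ∧-identityʳ x ⟩
  x                        ∎
  where open ≡-Reasoning

Periodic : ℕ → (ℕ → Bool) → Set
Periodic n f = ∀ i → f (i + n) ≡ f i

periodic-* : ∀ {n f} → Periodic n f → ∀ q i → f (i + q * n) ≡ f i
periodic-* {n} {f} per zero    i = cong f (+-identityʳ i)
periodic-* {n} {f} per (suc q) i = begin
  f (i + (n + q * n))  ≡⟨ cong f (m+[n+o]≡m+o+n i n (q * n)) ⟩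
  f (i + q * n + n)    ≡⟨ per (i + q * n) ⟩
  f (i + q * n)        ≡⟨ periodic-* per q i ⟩
  f i                  ∎
  where open ≡-Reasoning

periodic-% : ∀ {n f} .{{_ : NonZero n}} → Periodic n f → ∀ i → f (i % n) ≡ f i
periodic-% {n} {f} per i =
  trans (sym (periodic-* per (i / n) (i % n))) (cong f (sym (m≡m%n+[m/n]*n i n)))

periodic-double : ∀ {m f} → Periodic m f → Periodic (m + m) f
periodic-double {m} {f} per i =
  trans (cong f (sym (+-assoc i m m))) (trans (per (i + m)) (per i))

periodic-∧ : ∀ {n f g} → Periodic n f → Periodic n g → Periodic n (λ i → f i ∧ g i)
periodic-∧ f-per g-per i = cong₂ _∧_ (f-per i) (g-per i)

periodic-vanish : ∀ {n f} .{{_ : NonZero n}} → Periodic n f →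
  (∀ j → j < n → f j ≡ false) → ∀ j → f j ≡ false
periodic-vanish {n} per below j = trans (sym (periodic-% per j)) (below (j % n) (m%n<n j n))

sum₂-rotate₁ : ∀ n f → Periodic n f → sum₂ n (λ i → f (suc i)) ≡ sum₂ n f
sum₂-rotate₁ zero    f per = refl
sum₂-rotate₁ (suc n) f per =
  trans (sum₂-snoc n (λ i → f (suc i)))
        (trans (cong (sum₂ n (λ i → f (suc i)) xor_) (per 0)) (xor-comm _ (f 0)))

sum₂-rotate : ∀ n f → Periodic n f → ∀ k → sum₂ n (λ i → f (k + i)) ≡ sum₂ n f
sum₂-rotate n f per zero    = refl
sum₂-rotate n f per (suc k) =
  trans (sum₂-cong n (λ i → cong f (sym (+-suc k i))))
  (trans (sum₂-rotate₁ n (λ i → f (k + i)) (λ i → trans (cong f (sym (+-assoc k i n))) (per (k + i))))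
        (sum₂-rotate n f per k))

residue : ℕ → ℕ → (ℕ → Bool) → ℕ → Bool
residue a m f j = sum₂ a (λ p → f (p * m + j))

sum₂-residues : ∀ a m f G → Periodic m G →
  sum₂ (a * m) (λ i → f i ∧ G i) ≡ sum₂ m (λ j → residue a m f j ∧ G j)
sum₂-residues a m f G per = begin
  sum₂ (a * m) (λ i → f i ∧ G i)
    ≡⟨ sum₂-blocks a m _ ⟩
  sum₂ a (λ p → sum₂ m (λ j → f (p * m + j) ∧ G (p * m + j)))
    ≡⟨ sum₂-cong a (λ p → sum₂-cong m (λ j → cong (f (p * m + j) ∧_) (G-block p j))) ⟩
  sum₂ a (λ p → sum₂ m (λ j → f (p * m + j) ∧ G j))
    ≡⟨ sum₂-swap a m _ ⟩
  sum₂ m (λ j → sum₂ a (λ p → f (p * m + j) ∧ G j))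
    ≡⟨ sum₂-cong m (λ j → sum₂-∧ʳ a (G j) _) ⟩
  sum₂ m (λ j → residue a m f j ∧ G j)
    ∎
  where
  open ≡-Reasoning
  G-block : ∀ p j → G (p * m + j) ≡ G j
  G-block p j = trans (cong G (+-comm (p * m) j)) (periodic-* per p j)

residue-periodic : ∀ a m f → Periodic (a * m) f → Periodic m (residue a m f)
residue-periodic a m f per j = begin
  sum₂ a (λ p → f (p * m + (j + m)))  ≡⟨ sum₂-cong a (λ p → cong f (next-block p)) ⟩
  sum₂ a (λ p → column (suc p))       ≡⟨ sum₂-rotate₁ a column column-periodic ⟩
  sum₂ a column                       ∎
  where
  open ≡-Reasoning
  column : ℕ → Bool
  column p = f (p * m + j)
  next-block : ∀ p → p * m + (j + m) ≡ suc p * m + j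
  next-block p = arith p m j
    where
    arith : ∀ p m j → p * m + (j + m) ≡ m + p * m + j
    arith = solve-∀
  column-periodic : Periodic a column
  column-periodic p = trans (cong f (wrap p a m j)) (per (p * m + j))
    where
    wrap : ∀ p a m j → (p + a) * m + j ≡ p * m + j + a * m
    wrap = solve-∀

Dual : ℕ → (ℕ → Bool) → (ℕ → Bool) → Set
Dual m s g = Periodic m g × (∀ d → sum₂ m (λ j → s (d + j) ∧ g j) ≡ true)

dual-of-difference : ∀ m s g → Dual m (λ j → s j xor s (j + m)) g → Dual (m + m) s g
dual-of-difference m s g (g-per , g-dual) = periodic-double g-per , λ d → begin
  sum₂ (m + m) (λ j → s (d + j) ∧ g j)
    ≡⟨ sum₂-halves m _ ⟩
  sum₂ m (λ j → (s (d + j) ∧ g j) xor (s (d + (m + j)) ∧ g (m + j)))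
    ≡⟨ sum₂-cong m (λ j → cong₂ (λ x y → (s (d + j) ∧ g j) xor (s x ∧ y))
                                 (m+[n+o]≡m+o+n d m j) (trans (cong g (+-comm m j)) (g-per j))) ⟩
  sum₂ m (λ j → (s (d + j) ∧ g j) xor (s (d + j + m) ∧ g j))
    ≡⟨ sum₂-cong m (λ j → sym (∧-distribʳ-xor (g j) (s (d + j)) (s (d + j + m)))) ⟩
  sum₂ m (λ j → (s (d + j) xor s (d + j + m)) ∧ g j)
    ≡⟨ g-dual d ⟩
  true
    ∎
  where open ≡-Reasoning

firstHalf : (m : ℕ) .{{_ : NonZero m}} → ℕ → Bool
firstHalf m j = not (isOdd (j / m))

firstHalf-flip : ∀ m .{{_ : NonZero m}} j → firstHalf m (m + j) ≡ not (firstHalf m j)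
firstHalf-flip m j =
  cong (λ q → not (isOdd q)) (trans (+-distrib-/-∣ˡ j (∣-refl {m})) (cong (_+ j / m) (n/n≡1 m)))

dual-of-periodic : ∀ m .{{_ : NonZero m}} s g → Periodic m s → Dual m s g →
  Dual (m + m) s (λ j → g j ∧ firstHalf m j)
dual-of-periodic m s g s-per (g-per , g-dual) = g′-per , λ d → begin
  sum₂ (m + m) (λ j → s (d + j) ∧ g′ j)
    ≡⟨ sum₂-halves m _ ⟩
  sum₂ m (λ j → (s (d + j) ∧ g′ j) xor (s (d + (m + j)) ∧ g′ (m + j)))
    ≡⟨ sum₂-cong m (λ j → cong (λ x → (s (d + j) ∧ g′ j) xor (s x ∧ g′ (m + j)))
                               (m+[n+o]≡m+o+n d m j)) ⟩
  sum₂ m (λ j → (s (d + j) ∧ g′ j) xor (s (d + j + m) ∧ g′ (m + j)))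
    ≡⟨ sum₂-cong m (λ j → cong (λ x → (s (d + j) ∧ g′ j) xor (x ∧ g′ (m + j)))
                               (s-per (d + j))) ⟩
  sum₂ m (λ j → (s (d + j) ∧ g′ j) xor (s (d + j) ∧ g′ (m + j)))
    ≡⟨ sum₂-cong m (λ j → trans (sym (∧-distribˡ-xor (s (d + j)) (g′ j) (g′ (m + j))))
                                (cong (s (d + j) ∧_) (g′-halves j))) ⟩
  sum₂ m (λ j → s (d + j) ∧ g j)
    ≡⟨ g-dual d ⟩
  true
    ∎
  where
  open ≡-Reasoning
  g′ : ℕ → Bool
  g′ j = g j ∧ firstHalf m j
  g-shift : ∀ j → g (m + j) ≡ g j
  g-shift j = trans (cong g (+-comm m j)) (g-per j)
  g′-halves : ∀ j → g′ j xor g′ (m + j) ≡ g j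
  g′-halves j = begin
    g′ j xor (g (m + j) ∧ firstHalf m (m + j))
      ≡⟨ cong₂ (λ x y → g′ j xor (x ∧ y)) (g-shift j) (firstHalf-flip m j) ⟩
    (g j ∧ firstHalf m j) xor (g j ∧ not (firstHalf m j))
      ≡⟨ ∧-split (g j) (firstHalf m j) ⟩
    g j
      ∎
  g′-per : Periodic (m + m) g′
  g′-per i = cong₂ _∧_ (periodic-double g-per i) (begin
    firstHalf m (i + (m + m))  ≡⟨ cong (firstHalf m) (double-shift i m) ⟩
    firstHalf m (m + (m + i))  ≡⟨ trans (firstHalf-flip m (m + i)) (cong not (firstHalf-flip m i)) ⟩
    not (not (firstHalf m i))  ≡⟨ not-involutive _ ⟩
    firstHalf m i              ∎)
    where
    double-shift : ∀ i m → i + (m + m) ≡ m + (m + i)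
    double-shift = solve-∀

-- Key lemma: every 2^b-periodic sequence s over 𝔽₂ that is not identically 0
-- has a dual with period 2^b.  (Algebraically: in 𝔽₂[t]/(t^{2^b} - 1) = 𝔽₂[u]/(u^{2^b})
-- with u = t + 1, the all-ones element u^{2^b - 1} is a multiple of every nonzero element.)
-- Induction on b, with m = 2^{b-1}: for b = 0, s is constantly 1 and so is its
-- dual; otherwise either s + (s shifted by m) is not identically 0
-- (dual-of-difference), or s has period m (dual-of-periodic).
dual-exists : ∀ b s → Periodic (2 ^ b) s → ∀ j → s j ≡ true → ∃ λ g → Dual (2 ^ b) s g
dual-exists zero s per j sj = (λ _ → true) , (λ _ → refl) , λ d →
  trans (xor-identityʳ _) (trans (∧-identityʳ _) (trans (constant (d + 0)) (trans (sym (constant j)) sj)))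
  where
  constant : ∀ i → s i ≡ s 0
  constant zero    = refl
  constant (suc i) = trans (cong s (+-comm 1 i)) (trans (per i) (constant i))
dual-exists (suc b) s per j sj =
  subst (λ k → ∃ λ g → Dual k s g) (sym 2m≡m+m) (dual (true-or-false-below m difference))
  where
  m : ℕ
  m = 2 ^ b
  instance
    m≢0 : NonZero m
    m≢0 = m^n≢0 2 b
  2m≡m+m : 2 ^ suc b ≡ m + m
  2m≡m+m = cong (m +_) (+-identityʳ m)
  s-per₂ : Periodic (m + m) s
  s-per₂ = subst (λ k → Periodic k s) 2m≡m+m per
  difference : ℕ → Bool
  difference i = s i xor s (i + m)
  difference-per : Periodic m difference
  difference-per i =
    trans (cong (s (i + m) xor_) (trans (cong s (+-assoc i m m)) (s-per₂ i))) (xor-comm _ (s i))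
  s-per : (∀ j → j < m → difference j ≡ false) → Periodic m s
  s-per below i = sym (xor≡false⇒≡ (s i) (s (i + m)) (periodic-vanish difference-per below i))
  dual : (∃ λ j → difference j ≡ true) ⊎ (∀ j → j < m → difference j ≡ false) →
         ∃ λ g → Dual (m + m) s g
  dual (inj₁ (j′ , dj′)) with dual-exists b difference difference-per j′ dj′
  ... | g , g-dual = g , dual-of-difference m s g g-dual
  dual (inj₂ below) with dual-exists b s (s-per below) j sj
  ... | g , g-dual = _ , dual-of-periodic m s g (s-per below) g-dual

extend : ∀ {n} .{{_ : NonZero n}} → F2^ n → ℕ → Bool
extend {n} x y = x (y mod n)

Σ₂-sum₂ : ∀ {n} (f : Fin n → Bool) (G : ℕ → Bool) →
  (∀ i → G (toℕ i) ≡ f i) → Σ₂ f ≡ sum₂ n G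
Σ₂-sum₂ {zero}  f G agree = refl
Σ₂-sum₂ {suc n} f G agree =
  cong₂ _xor_ (sym (agree zero)) (Σ₂-sum₂ (λ i → f (suc i)) (λ i → G (suc i)) (λ i → agree (suc i)))

toℕ-cpred : ∀ {n} (i : Fin (suc n)) → toℕ (cpred i) ≡ (toℕ i + n) % suc n
toℕ-cpred {n} zero    = trans (toℕ-fromℕ n) (sym (m<n⇒m%n≡m (n<1+n n)))
toℕ-cpred {n} (suc i) = begin
  toℕ (inject₁ i)             ≡⟨ toℕ-inject₁ i ⟩
  toℕ i                       ≡⟨ sym (m<n⇒m%n≡m (m<n⇒m<1+n (toℕ<n i))) ⟩
  toℕ i % suc n               ≡⟨ sym ([m+n]%n≡m%n (toℕ i) (suc n)) ⟩
  (toℕ i + suc n) % suc n     ≡⟨ cong (_% suc n) (+-suc (toℕ i) n) ⟩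
  (suc (toℕ i) + n) % suc n   ∎
  where open ≡-Reasoning

cpred-mod : ∀ {n} y → cpred (suc y mod suc n) ≡ y mod suc n
cpred-mod {n} y = toℕ-injective (begin
  toℕ (cpred (suc y mod N))             ≡⟨ toℕ-cpred (suc y mod N) ⟩
  (toℕ (suc y mod N) + n) % N           ≡⟨ cong (λ t → (t + n) % N) (toℕ-fromℕ< (m%n<n (suc y) N)) ⟩
  (suc y % N + n) % N                   ≡⟨ cong (λ t → (suc y % N + t) % N) (sym (m<n⇒m%n≡m (n<1+n n))) ⟩
  (suc y % N + n % N) % N               ≡⟨ sym (%-distribˡ-+ (suc y) n N) ⟩
  (suc y + n) % N                       ≡⟨ cong (_% N) (sym (+-suc y n)) ⟩
  (y + N) % N                           ≡⟨ [m+n]%n≡m%n y N ⟩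
  y % N                                 ≡⟨ sym (toℕ-fromℕ< (m%n<n y N)) ⟩
  toℕ (y mod N)                         ∎)
  where
  open ≡-Reasoning
  N : ℕ
  N = suc n

extend-σ : ∀ {n} .{{_ : NonZero n}} (x : F2^ n) (y : ℕ) → extend (σ x) (suc y) ≡ extend x y
extend-σ {suc n} x y = cong x (cpred-mod y)

module _ {n : ℕ} .{{_ : NonZero n}} where

  extend-toℕ : (x : F2^ n) (i : Fin n) → extend x (toℕ i) ≡ x i
  extend-toℕ x i = cong x (toℕ-injective (trans (toℕ-fromℕ< _) (m<n⇒m%n≡m (toℕ<n i))))

  extend-periodic : (x : F2^ n) → Periodic n (extend x)
  extend-periodic x i =
    cong x (toℕ-injective (trans (toℕ-fromℕ< _) (trans ([m+n]%n≡m%n i n) (sym (toℕ-fromℕ< _)))))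

  extend-σ^ : ∀ k (x : F2^ n) y → extend (σ^ k x) (k + y) ≡ extend x y
  extend-σ^ zero    x y = refl
  extend-σ^ (suc k) x y = trans (extend-σ (σ^ k x) (k + y)) (extend-σ^ k x y)

correlation : ∀ {n} .{{_ : NonZero n}} → F2^ n → F2^ n → ℕ → Bool
correlation {n} v x k = sum₂ n (λ i → extend v (k + i) ∧ extend x i)

module _ {n : ℕ} .{{_ : NonZero n}} (v x : F2^ n) where

  ·-σ^ : ∀ k → v · σ^ k x ≡ correlation v x k
  ·-σ^ k = begin
    Σ₂ (λ i → v i ∧ σ^ k x i)
      ≡⟨ Σ₂-sum₂ _ _ (λ i → cong₂ _∧_ (extend-toℕ v i) (extend-toℕ (σ^ k x) i)) ⟩
    sum₂ n (λ i → extend v i ∧ extend (σ^ k x) i)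
      ≡⟨ sym (sum₂-rotate n _ (periodic-∧ (extend-periodic v) (extend-periodic (σ^ k x))) k) ⟩
    sum₂ n (λ i → extend v (k + i) ∧ extend (σ^ k x) (k + i))
      ≡⟨ sum₂-cong n (λ i → cong (extend v (k + i) ∧_) (extend-σ^ k x i)) ⟩
    correlation v x k
      ∎
    where open ≡-Reasoning

  correlation-% : ∀ k → correlation v x (k % n) ≡ correlation v x k
  correlation-% k = sum₂-cong n (λ i → cong (_∧ extend x i) (periodic-% (shifted-periodic i) k))
    where
    shifted-periodic : ∀ i → Periodic n (λ k → extend v (k + i))
    shifted-periodic i k =
      trans (cong (extend v) (m+n+o≡m+o+n k n i)) (extend-periodic v (k + i))

works⇔correlation-vanishes : ∀ {n} .{{_ : NonZero n}} (v : F2^ n) →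
  Works v ⇔ ((x : F2^ n) → ∃ λ k → correlation v x k ≡ false)
works⇔correlation-vanishes {n} v = mk⇔
  (λ works x → shift-of-dot x (works x))
  (λ vanishes x → dot-of-shift x (vanishes x))
  where
  open ≡-Reasoning
  shift-of-dot : ∀ x → (∃ λ (k : Fin n) → v · σ^ (toℕ k) x ≡ false) →
                 ∃ λ k → correlation v x k ≡ false
  shift-of-dot x (k , vanish) = toℕ k , trans (sym (·-σ^ v x (toℕ k))) vanish
  dot-of-shift : ∀ x → (∃ λ k → correlation v x k ≡ false) →
                 ∃ λ (k : Fin n) → v · σ^ (toℕ k) x ≡ false
  dot-of-shift x (k , vanish) = k mod n , (begin
    v · σ^ (toℕ (k mod n)) x        ≡⟨ ·-σ^ v x _ ⟩
    correlation v x (toℕ (k mod n)) ≡⟨ cong (correlation v x) (toℕ-fromℕ< (m%n<n k n)) ⟩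
    correlation v x (k % n)         ≡⟨ correlation-% v x k ⟩
    correlation v x k               ≡⟨ vanish ⟩
    false                           ∎)

-- If all residues of v modulo m vanish and a is odd, v works: the correlations
-- at the a shifts 0, m, …, (a - 1)m sum to the pairing of the (vanishing)
-- residues of v with those of x, yet a odd correlations equal to 1 would sum to 1.
residues-vanish⇒works : ∀ {n} .{{_ : NonZero n}} a m → n ≡ a * m → isOdd a ≡ true →
  (v : F2^ n) → (∀ j → j < m → residue a m (extend v) j ≡ false) → Works v
residues-vanish⇒works a m refl a-odd v vanish =
  Equivalence.from (works⇔correlation-vanishes v) λ x →
    [ (λ (l , corr-l) → l * m , corr-l)
    , (λ all-one → contradiction (trans (sym (sum-of-correlations x)) (trans all-one a-odd)) λ ())
    ]′ (sum₂-false-or-parity a (λ l → correlation v x (l * m)))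
  where
  R : ℕ → Bool
  R = residue a m (extend v)
  R-periodic : Periodic m R
  R-periodic = residue-periodic a m (extend v) (extend-periodic v)
  sum-of-correlations : ∀ x → sum₂ a (λ l → correlation v x (l * m)) ≡ false
  sum-of-correlations x = begin
    sum₂ a (λ l → sum₂ (a * m) (λ i → extend v (l * m + i) ∧ extend x i))
      ≡⟨ sum₂-swap a (a * m) _ ⟩
    sum₂ (a * m) (λ i → sum₂ a (λ l → extend v (l * m + i) ∧ extend x i))
      ≡⟨ sum₂-cong (a * m) (λ i → trans (sum₂-∧ʳ a (extend x i) _) (∧-comm (R i) (extend x i))) ⟩
    sum₂ (a * m) (λ i → extend x i ∧ R i)
      ≡⟨ sum₂-residues a m (extend x) R R-periodic ⟩
    sum₂ m (λ j → residue a m (extend x) j ∧ R j)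
      ≡⟨ sum₂-cong< m (λ j j<m → trans (cong (_ ∧_) (vanish j j<m)) (∧-zeroʳ _)) ⟩
    sum₂ m (λ _ → false)
      ≡⟨ sum₂-zero m ⟩
    false
      ∎
    where open ≡-Reasoning

-- The residues of a working vector have no dual: the correlation of v with a
-- dual g of its residues is the correlation of the residues with g, hence 1
-- at every shift.
works⇒no-dual : ∀ {n} .{{_ : NonZero n}} a m → n ≡ a * m →
  (v : F2^ n) → Works v → ∀ g → ¬ Dual m (residue a m (extend v)) g
works⇒no-dual a m refl v works g (g-per , g-dual) =
  let (k , vanish) = Equivalence.to (works⇔correlation-vanishes v) works x
  in contradiction (trans (sym (correlation-with-g k)) vanish) λ ()
  where
  x : F2^ (a * m)
  x i = g (toℕ i)
  extend-x : ∀ y → extend x y ≡ g y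
  extend-x y = trans (cong g (toℕ-fromℕ< _)) (periodic-% (periodic-* g-per a) y)
  correlation-with-g : ∀ k → correlation v x k ≡ true
  correlation-with-g k = begin
    sum₂ (a * m) (λ i → extend v (k + i) ∧ extend x i)
      ≡⟨ sum₂-cong (a * m) (λ i → cong (extend v (k + i) ∧_) (extend-x i)) ⟩
    sum₂ (a * m) (λ i → extend v (k + i) ∧ g i)
      ≡⟨ sum₂-residues a m (λ i → extend v (k + i)) g g-per ⟩
    sum₂ m (λ j → residue a m (λ i → extend v (k + i)) j ∧ g j)
      ≡⟨ sum₂-cong m (λ j → cong (_∧ g j)
           (sum₂-cong a (λ p → cong (extend v) (m+[n+o]≡n+[m+o] k (p * m) j)))) ⟩
    sum₂ m (λ j → residue a m (extend v) (k + j) ∧ g j)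
      ≡⟨ g-dual k ⟩
    true
      ∎
    where open ≡-Reasoning

works⇒residues-vanish : ∀ {n} .{{_ : NonZero n}} a b → n ≡ a * 2 ^ b →
  (v : F2^ n) → Works v → ∀ j → residue a (2 ^ b) (extend v) j ≡ false
works⇒residues-vanish a b refl v works j with residue a (2 ^ b) (extend v) j in Rj
... | false = refl
... | true  =
  let (g , dual) = dual-exists b _ (residue-periodic a (2 ^ b) (extend v) (extend-periodic v)) j Rj
  in contradiction dual (works⇒no-dual a (2 ^ b) refl v works g)

works⇔residues-vanish : ∀ {n} .{{_ : NonZero n}} a b → n ≡ a * 2 ^ b → isOdd a ≡ true →
  (v : F2^ n) → Works v ⇔ (∀ j → j < 2 ^ b → residue a (2 ^ b) (extend v) j ≡ false)
works⇔residues-vanish a b n≡ a-odd v = mk⇔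
  (λ works j _ → works⇒residues-vanish a b n≡ v works j)
  (residues-vanish⇒works a (2 ^ b) n≡ a-odd v)

residue-column : ∀ a m .{{_ : NonZero (a * m)}} (v : F2^ (a * m)) (j : Fin m) (f : F2^ a) →
  (∀ i → v (combine i j) ≡ f i) → residue a m (extend v) (toℕ j) ≡ Σ₂ f
residue-column a m v j f column≡f = sym (Σ₂-sum₂ f _ λ i → begin
  extend v (toℕ i * m + toℕ j)   ≡⟨ cong (λ t → extend v (t + toℕ j)) (*-comm (toℕ i) m) ⟩
  extend v (m * toℕ i + toℕ j)   ≡⟨ cong (extend v) (sym (toℕ-combine i j)) ⟩
  extend v (toℕ (combine i j))   ≡⟨ extend-toℕ v (combine i j) ⟩
  v (combine i j)                ≡⟨ column≡f i ⟩
  f i                            ∎)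
  where open ≡-Reasoning

-- First part of the theorem: for n odd, v works iff |v| = 0 (the case b = 0,
-- where the only residue is the weight of v).
odd-length-criterion : (n : ℕ) → Odd n → (v : F2^ n) → Works v ⇔ (∣ v ∣₂ ≡ false)
odd-length-criterion .(suc (2 * k)) (k , refl) v = mk⇔
  (λ works → trans weight (Equivalence.to criterion works 0 (s≤s z≤n)))
  (λ even → Equivalence.from criterion λ { zero _ → trans (sym weight) even ; (suc _) (s≤s ()) })
  where
  n : ℕ
  n = suc (2 * k)
  criterion : Works v ⇔ (∀ j → j < 1 → residue n 1 (extend v) j ≡ false)
  criterion = works⇔residues-vanish n 0 (sym (*-identityʳ n)) (isOdd-odd k) v
  weight : ∣ v ∣₂ ≡ residue n 1 (extend v) 0
  weight = Σ₂-sum₂ v (λ p → extend v (p * 1 + 0))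
             (λ i → trans (cong (extend v) (p*1+0≡p (toℕ i))) (extend-toℕ v i))
    where
    p*1+0≡p : ∀ p → p * 1 + 0 ≡ p
    p*1+0≡p p = trans (+-identityʳ _) (*-identityʳ p)

columns-criterion : (a b : ℕ) → Odd a → (v : F2^ (a * 2 ^ b)) →
  Works v ⇔ (∃ λ (w : Fin (2 ^ b) → F2^ a) →
    ((j : Fin (2 ^ b)) → Works (w j)) × ((i : Fin a) (j : Fin (2 ^ b)) → v (combine i j) ≡ w j i))
columns-criterion .(suc (2 * k)) b (k , refl) v = mk⇔
  (λ works → column , (λ j → Equivalence.from (column-criterion (column j))
       (trans (sym (residue-column a m v j (column j) (λ i → refl)))
              (Equivalence.to criterion works (toℕ j) (toℕ<n j))))
     , (λ i j → refl))
  (λ (w , w-works , v≡w) → Equivalence.from criterion λ j j<m →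
    let J = fromℕ< j<m in begin
      residue a m (extend v) j          ≡⟨ cong (residue a m (extend v)) (sym (toℕ-fromℕ< j<m)) ⟩
      residue a m (extend v) (toℕ J)    ≡⟨ residue-column a m v J (w J) (λ i → v≡w i J) ⟩
      Σ₂ (w J)                          ≡⟨ Equivalence.to (column-criterion (w J)) (w-works J) ⟩
      false                             ∎)
  where
  open ≡-Reasoning
  a m : ℕ
  a = suc (2 * k)
  m = 2 ^ b
  instance
    am≢0 : NonZero (a * m)
    am≢0 = m*n≢0 a m {{_}} {{m^n≢0 2 b}}
  criterion : Works v ⇔ (∀ j → j < m → residue a m (extend v) j ≡ false)
  criterion = works⇔residues-vanish a b refl (isOdd-odd k) v
  column-criterion : (u : F2^ a) → Works u ⇔ (∣ u ∣₂ ≡ false)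
  column-criterion = odd-length-criterion a (k , refl)
  column : Fin m → F2^ a
  column j i = v (combine i j)

theorem2p5 :
    ((n : ℕ) → Odd n → (v : F2^ n) → Works v ⇔ (∣ v ∣₂ ≡ false))
    × ((a b : ℕ) → Odd a → (v : F2^ (a * 2 ^ b)) →
        Works v ⇔ (∃ λ (w : Fin (2 ^ b) → F2^ a) →
          ((j : Fin (2 ^ b)) → Works (w j))
          × ((i : Fin a) (j : Fin (2 ^ b)) → v (combine i j) ≡ w j i)))
theorem2p5 = odd-length-criterion , columns-criterion
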